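{- Let $d\ge 2$ be an integer and let $S$ be a set with $d-1$ elements. A Moore graph of diameter $2$ and degree $d$ exists if and only if there exist permutations $\theta_{ij}$ of $S$, for $1\le i<j\le d$, such that, setting $\theta_{ji}=\theta_{ij}^{ -1}$ for $i<j$, for all pairwise distinct indices $i,j,k,l\in\{1,\dots,d\}$ the following permutations of $S$ have no fixed points: (a) $\theta_{ki}\theta_{ij}\theta_{jk}$; (b) $\theta_{lk}\theta_{ki}\theta_{ij}\theta_{jl}$.
   Context: A Moore graph of diameter 2 and degree $d$ is a $d$-regular graph of diameter $2$ and girth $5$; equivalently a $d$-regular graph of diameter $2$ on $d^2+1$ vertices. Products of permutations denote composition. -}

module Defs where

open import Data.Nat using (ℕ; _*_; _+_)
open import Data.Bool using (Bool; true; false)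
open import Data.Fin using (Fin) renaming (_<_ to _<ᶠ_)
open import Data.Fin.Properties using (<-cmp)
open import Data.List using (length; filterᵇ; allFin)
open import Data.Product using (Σ; _×_; ∃; _,_)
open import Data.Sum using (_⊎_)
open import Relation.Binary.PropositionalEquality using (_≡_; _≢_)
open import Relation.Binary.Definitions using (tri<; tri≈; tri>)
open import Relation.Nullary using (¬_)
open import Function using (id)
open import Function.Bundles using (Inverse; _↔_)

record SimpleGraph (n : ℕ) : Set where
  field
    adj       : Fin n → Fin n → Bool
    irrefl    : ∀ u → adj u u ≡ false
    symmetric : ∀ u v → adj u v ≡ adj v u

open SimpleGraph public

Adjacent : ∀ {n} → SimpleGraph n → Fin n → Fin n → Set
Adjacent G u v = adj G u v ≡ true

degree : ∀ {n} → SimpleGraph n → Fin n → ℕ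
degree {n} G u = length (filterᵇ (adj G u) (allFin n))

IsRegular : ∀ {n} → SimpleGraph n → ℕ → Set
IsRegular {n} G d = ∀ (u : Fin n) → degree G u ≡ d

HasDiameterTwo : ∀ {n} → SimpleGraph n → Set
HasDiameterTwo {n} G =
  (∀ (u v : Fin n) → u ≢ v →
     Adjacent G u v ⊎ (∃ λ w → Adjacent G u w × Adjacent G w v))
  × (∃ λ u → ∃ λ v → u ≢ v × ¬ Adjacent G u v ×
       (∃ λ w → Adjacent G u w × Adjacent G w v))

-- Moore graph of diameter 2 and degree d: a d-regular graph of diameter 2
-- on d²+1 vertices (the equivalent characterisation given in the paper).
MooreGraph : ℕ → Set
MooreGraph d = Σ (SimpleGraph (d * d + 1)) λ G → IsRegular G d × HasDiameterTwo G

-- Given permutations θ i j for i < j, the extended family with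
-- θ_ji = θ_ij⁻¹ for i < j (the diagonal value is irrelevant; set to id).
θext : ∀ {d} {S : Set} → ((i j : Fin d) → i <ᶠ j → S ↔ S) → Fin d → Fin d → S → S
θext θ i j with <-cmp i j
... | tri< i<j _ _ = Inverse.to (θ i j i<j)
... | tri≈ _ _ _   = id
... | tri> _ _ j<i = Inverse.from (θ j i j<i)

FixedPointFree : {S : Set} → (S → S) → Set
FixedPointFree {S} f = ∀ (x : S) → f x ≢ x

-- Seen from a vertex o, a Moore graph of degree d consists of o, its neighbours u_i and,
-- for each i, d − 1 further neighbours f_i(s) of u_i (s ∈ S): counting shows these
-- 1 + d + d(d − 1) vertices are distinct and exhaust the graph, so there are no triangles and
-- any two vertices at distance two have a unique common neighbour. For i ≠ j the vertex
-- f_j(t) then has exactly one neighbour f_i(θ_ij t) in the i-th layer; a fixed point of (a)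
-- would close a triangle, one of (b) a quadrangle.
-- Conversely, the permutations define a graph on these vertices, joining f_j(t) to f_i(θ_ij t).
-- It is d-regular, and if f_i(s), f_j(t) are not adjacent they have a common neighbour
-- f_c(θ_cj t): by (a) and (b) the d − 2 elements θ_ic θ_cj t (c ≠ i, j) differ from each other
-- and from θ_ij t, hence exhaust the rest of S.
module Submission where

open import Defs
open import Data.Nat using (ℕ; suc; _≤_; _∸_; _*_; _+_; z≤n; s≤s)
open import Data.Nat.Properties using (1+n≰n)
open import Data.Bool using (Bool; true)
open import Data.Fin using (Fin; zero; suc; punchIn; punchOut) renaming (_<_ to _<ᶠ_)
open import Data.Fin.Properties
  using (_≟_; <-cmp; <-irrelevant; <⇒≢; any?; injective⇒≤; cantor-schröder-bernstein;
         punchIn-injective; punchInᵢ≢i; punchIn-punchOut; punchOut-injective; +↔⊎; *↔×; 1↔⊤)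
open import Data.List using (List; _∷_; length; filterᵇ; allFin; lookup)
open import Data.List.Membership.Propositional.Properties
  using (∈-lookup; ∈-allFin; ∈-filter⁺; ∈-filter⁻)
open import Data.List.Relation.Unary.All as All using ()
open import Data.List.Relation.Unary.AllPairs using (_∷_)
open import Data.List.Relation.Unary.Any using (index)
open import Data.List.Relation.Unary.Any.Properties using (lookup-index)
open import Data.List.Relation.Unary.Unique.Propositional using (Unique)
open import Data.List.Relation.Unary.Unique.Propositional.Properties using (allFin⁺; filter⁺)
open import Data.Bool.Properties using (T-≡)
open import Data.Product using (Σ; _×_; _,_; proj₁; proj₂; ∃)
open import Data.Sum using (_⊎_; inj₁; inj₂)
open import Data.Sum.Function.Propositional using (_⊎-↔_)
open import Data.Unit using (⊤; tt)
open import Function using (_∘_; _⇔_; mk⇔; _↔_; Inverse; mk↔ₛ′; Injection; Equivalence)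
open import Function.Definitions using (Injective; StrictlySurjective)
open import Function.Properties.Inverse using (↔-sym; ↔-trans; ↔⇒↣)
open import Relation.Binary.Definitions using (tri<; tri≈; tri>)
open import Relation.Binary.PropositionalEquality
open import Relation.Nullary using (¬_; Dec; yes; no; does; contradiction)
open import Relation.Nullary.Decidable using (T?; dec-true; dec-false; does-⇔; via-injection)

private
  variable
    m n : ℕ
    A B S : Set

↔-injective : (e : A ↔ B) → Injective _≡_ _≡_ (Inverse.to e)
↔-injective e = Injection.injective (↔⇒↣ e)

Fin-injective⇒surjective : {f : Fin n → Fin n} → Injective _≡_ _≡_ f → StrictlySurjective _≡_ f
Fin-injective⇒surjective {n} {f} f-inj y with any? (λ x → f x ≟ y)
... | yes hit = hit
Fin-injective⇒surjective {suc n} {f} f-inj y | no miss =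
  contradiction (injective⇒≤ (f-inj ∘ punchOut-injective (missed _) (missed _))) 1+n≰n
  where
  missed : ∀ x → y ≢ f x
  missed x y≡fx = miss (x , sym y≡fx)

-- A surjection onto a finite set has an injective section, which is therefore onto as well.
Fin-surjective⇒injective : {f : Fin n → Fin n} → StrictlySurjective _≡_ f → Injective _≡_ _≡_ f
Fin-surjective⇒injective {f = f} f-surj {x} {y} fx≡fy = begin
  x    ≡⟨ proj₂ (g-surj x) ⟨
  g x′ ≡⟨ cong g x′≡y′ ⟩
  g y′ ≡⟨ proj₂ (g-surj y) ⟩
  y    ∎
  where
  open ≡-Reasoning
  g : Fin _ → Fin _
  g z = proj₁ (f-surj z)
  f∘g : ∀ z → f (g z) ≡ z
  f∘g z = proj₂ (f-surj z)
  g-surj : StrictlySurjective _≡_ g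
  g-surj = Fin-injective⇒surjective λ {a} {b} ga≡gb →
    trans (sym (f∘g a)) (trans (cong f ga≡gb) (f∘g b))
  x′ y′ : Fin _
  x′ = proj₁ (g-surj x)
  y′ = proj₁ (g-surj y)
  x′≡y′ : x′ ≡ y′
  x′≡y′ = begin
    x′         ≡⟨ f∘g x′ ⟨
    f (g x′)   ≡⟨ cong f (proj₂ (g-surj x)) ⟩
    f x        ≡⟨ fx≡fy ⟩
    f y        ≡⟨ cong f (proj₂ (g-surj y)) ⟨
    f (g y′)   ≡⟨ f∘g y′ ⟩
    y′         ∎

↔Fin-surjective⇒injective : A ↔ Fin n → {f : A → Fin n} →
                            StrictlySurjective _≡_ f → Injective _≡_ _≡_ f
↔Fin-surjective⇒injective e {f} f-surj {x} {y} fx≡fy = ↔-injective e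
  (Fin-surjective⇒injective f∘from-surj
    (trans (cong f (strictlyInverseʳ x)) (trans fx≡fy (sym (cong f (strictlyInverseʳ y))))))
  where
  open Inverse e
  f∘from-surj : StrictlySurjective _≡_ (f ∘ from)
  f∘from-surj z = let (x , fx≡z) = f-surj z in to x , trans (cong f (strictlyInverseʳ x)) fx≡z

punctured-injective⇒surjective : {f : Fin m → Fin (suc m)} {p : Fin (suc m)} →
  (∀ r → p ≢ f r) → Injective _≡_ _≡_ f → ∀ y → p ≢ y → ∃ λ r → f r ≡ y
punctured-injective⇒surjective {f = f} {p} avoids f-inj y p≢y =
  let (r , hit) = Fin-injective⇒surjective g-inj (punchOut p≢y)
  in r , punchOut-injective (avoids r) p≢y hit
  where
  g : Fin _ → Fin _
  g r = punchOut (avoids r)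
  g-inj : Injective _≡_ _≡_ g
  g-inj = f-inj ∘ punchOut-injective (avoids _) (avoids _)

record Enumeration (P : Fin n → Set) (m : ℕ) : Set where
  field
    at           : Fin m → Fin n
    at-injective : Injective _≡_ _≡_ at
    at-sound     : ∀ r → P (at r)
    at-complete  : ∀ x → P x → ∃ λ r → at r ≡ x

module _ {P : Fin n → Set} {m m′ : ℕ} (E : Enumeration P m) (E′ : Enumeration P m′) where
  private
    module E = Enumeration E
    module E′ = Enumeration E′

  reindex : Fin m → Fin m′
  reindex r = proj₁ (E′.at-complete (E.at r) (E.at-sound r))

  reindex-injective : Injective _≡_ _≡_ reindex
  reindex-injective {r} {r′} eq = E.at-injective (begin
    E.at r               ≡⟨ proj₂ (E′.at-complete _ (E.at-sound r)) ⟨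
    E′.at (reindex r)    ≡⟨ cong E′.at eq ⟩
    E′.at (reindex r′)   ≡⟨ proj₂ (E′.at-complete _ (E.at-sound r′)) ⟩
    E.at r′              ∎)
    where open ≡-Reasoning

Enumeration-size-unique : {P : Fin n → Set} {m m′ : ℕ} → Enumeration P m → Enumeration P m′ → m ≡ m′
Enumeration-size-unique E E′ =
  cantor-schröder-bernstein (reindex-injective E E′) (reindex-injective E′ E)

lookup-injective : {xs : List A} → Unique xs → Injective _≡_ _≡_ (lookup xs)
lookup-injective (_ ∷ _) {zero} {zero} _ = refl
lookup-injective (x∉xs ∷ _) {zero} {suc j} eq = contradiction eq (All.lookup x∉xs (∈-lookup j))
lookup-injective (x∉xs ∷ _) {suc i} {zero} eq = contradiction (sym eq) (All.lookup x∉xs (∈-lookup i))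
lookup-injective (_ ∷ u) {suc i} {suc j} eq = cong suc (lookup-injective u eq)

filterᵇ-enumeration : (p : Fin n → Bool) →
                      Enumeration (λ x → p x ≡ true) (length (filterᵇ p (allFin n)))
filterᵇ-enumeration {n} p = record
  { at           = lookup xs
  ; at-injective = lookup-injective (filter⁺ (T? ∘ p) (allFin⁺ n))
  ; at-sound     = λ r →
      Equivalence.to T-≡ (proj₂ (∈-filter⁻ (T? ∘ p) {xs = allFin n} (∈-lookup r)))
  ; at-complete  = λ x px →
      let x∈xs = ∈-filter⁺ (T? ∘ p) (∈-allFin x) (Equivalence.from T-≡ px)
      in index x∈xs , sym (lookup-index x∈xs)
  }
  where
  xs = filterᵇ p (allFin n)

-- A vertex of a Moore graph as seen from a fixed root: the root, one of its d neighbours,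
-- or one of the d − 1 further neighbours (labelled by S) of the i-th neighbour.
data Vertex (d : ℕ) (S : Set) : Set where
  root   : Vertex d S
  layer₁ : Fin d → Vertex d S
  layer₂ : Fin d → S → Vertex d S

module _ {d : ℕ} where

  layer₂-injectiveˡ : ∀ {i j : Fin d} {s t : S} → layer₂ i s ≡ layer₂ j t → i ≡ j
  layer₂-injectiveˡ refl = refl

  layer₂-injectiveʳ : ∀ {i : Fin d} {s t : S} → layer₂ i s ≡ layer₂ i t → s ≡ t
  layer₂-injectiveʳ refl = refl

opaque
  Vertex↔Fin : ∀ {k} → S ↔ Fin k → Vertex (suc k) S ↔ Fin (suc k * suc k + 1)
  Vertex↔Fin {S = S} {k} σ = ↔-trans Vertex↔grid (↔-sym (↔-trans +↔⊎ (*↔× ⊎-↔ 1↔⊤)))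
    where
    open Inverse σ
    to′ : Vertex (suc k) S → (Fin (suc k) × Fin (suc k)) ⊎ ⊤
    to′ root         = inj₂ tt
    to′ (layer₁ i)   = inj₁ (i , zero)
    to′ (layer₂ i s) = inj₁ (i , suc (to s))
    from′ : (Fin (suc k) × Fin (suc k)) ⊎ ⊤ → Vertex (suc k) S
    from′ (inj₂ tt)           = root
    from′ (inj₁ (i , zero))   = layer₁ i
    from′ (inj₁ (i , suc r))  = layer₂ i (from r)
    Vertex↔grid : Vertex (suc k) S ↔ ((Fin (suc k) × Fin (suc k)) ⊎ ⊤)
    Vertex↔grid = mk↔ₛ′ to′ from′
      (λ { (inj₂ tt) → refl ; (inj₁ (i , zero)) → refl
         ; (inj₁ (i , suc r)) → cong (λ r → inj₁ (i , suc r)) (strictlyInverseˡ r) })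
      (λ { root → refl ; (layer₁ i) → refl ; (layer₂ i s) → cong (layer₂ i) (strictlyInverseʳ s) })

≢⇒<⊎> : {i j : Fin n} → i ≢ j → i <ᶠ j ⊎ j <ᶠ i
≢⇒<⊎> {i = i} {j} i≢j with <-cmp i j
... | tri< i<j _ _ = inj₁ i<j
... | tri≈ _ i≡j _ = contradiction i≡j i≢j
... | tri> _ _ j<i = inj₂ j<i

module _ {d : ℕ} (θ : (i j : Fin d) → i <ᶠ j → S ↔ S) where

  θext-< : ∀ {i j} (i<j : i <ᶠ j) → ∀ x → θext θ i j x ≡ Inverse.to (θ i j i<j) x
  θext-< {i} {j} i<j x with <-cmp i j
  ... | tri< i<j′ _ _ rewrite <-irrelevant i<j i<j′ = refl
  ... | tri≈ i≮j _ _ = contradiction i<j i≮j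
  ... | tri> i≮j _ _ = contradiction i<j i≮j

  θext-> : ∀ {i j} (j<i : j <ᶠ i) → ∀ x → θext θ i j x ≡ Inverse.from (θ j i j<i) x
  θext-> {i} {j} j<i x with <-cmp i j
  ... | tri< _ _ j≮i = contradiction j<i j≮i
  ... | tri≈ _ _ j≮i = contradiction j<i j≮i
  ... | tri> _ _ j<i′ rewrite <-irrelevant j<i j<i′ = refl

  θext-involutive : ∀ {i j} → i ≢ j → ∀ x → θext θ i j (θext θ j i x) ≡ x
  θext-involutive {i} {j} i≢j x with ≢⇒<⊎> i≢j
  ... | inj₁ i<j = begin
    θext θ i j (θext θ j i x)               ≡⟨ θext-< i<j _ ⟩
    Inverse.to (θ i j i<j) (θext θ j i x)   ≡⟨ cong (Inverse.to (θ i j i<j)) (θext-> i<j x) ⟩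
    Inverse.to (θ i j i<j) (Inverse.from (θ i j i<j) x) ≡⟨ Inverse.strictlyInverseˡ (θ i j i<j) x ⟩
    x                                       ∎
    where open ≡-Reasoning
  ... | inj₂ j<i = begin
    θext θ i j (θext θ j i x)               ≡⟨ θext-> j<i _ ⟩
    Inverse.from (θ j i j<i) (θext θ j i x) ≡⟨ cong (Inverse.from (θ j i j<i)) (θext-< j<i x) ⟩
    Inverse.from (θ j i j<i) (Inverse.to (θ j i j<i) x) ≡⟨ Inverse.strictlyInverseʳ (θ j i j<i) x ⟩
    x                                       ∎
    where open ≡-Reasoning

module _ {d : ℕ} (h : Fin d → Fin d → S → S)
         (h-involutive : ∀ {i j} → i ≢ j → ∀ x → h i j (h j i x) ≡ x) where

  permutationsOf : (i j : Fin d) → i <ᶠ j → S ↔ S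
  permutationsOf i j i<j =
    mk↔ₛ′ (h i j) (h j i) (h-involutive (<⇒≢ i<j)) (h-involutive (≢-sym (<⇒≢ i<j)))

  θext-permutationsOf : ∀ {i j} → i ≢ j → ∀ x → θext permutationsOf i j x ≡ h i j x
  θext-permutationsOf i≢j x with ≢⇒<⊎> i≢j
  ... | inj₁ i<j = θext-< permutationsOf i<j x
  ... | inj₂ j<i = θext-> permutationsOf j<i x

module _ {d : ℕ} {S : Set} where

  TriangleCondition : (Fin d → Fin d → S → S) → Set
  TriangleCondition θ = ∀ (i j k : Fin d) → i ≢ j → i ≢ k → j ≢ k →
    FixedPointFree (θ k i ∘ θ i j ∘ θ j k)

  QuadrangleCondition : (Fin d → Fin d → S → S) → Set
  QuadrangleCondition θ = ∀ (i j k l : Fin d) → i ≢ j → i ≢ k → i ≢ l → j ≢ k → j ≢ l → k ≢ l →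
    FixedPointFree (θ l k ∘ θ k i ∘ θ i j ∘ θ j l)

  module _ {θ θ′ : Fin d → Fin d → S → S} (θ≗θ′ : ∀ {i j} → i ≢ j → ∀ x → θ i j x ≡ θ′ i j x) where

    TriangleCondition-cong : TriangleCondition θ → TriangleCondition θ′
    TriangleCondition-cong triangle i j k i≢j i≢k j≢k x fixed = triangle i j k i≢j i≢k j≢k x (begin
      θ k i (θ i j (θ j k x))     ≡⟨ θ≗θ′ (≢-sym i≢k) _ ⟩
      θ′ k i (θ i j (θ j k x))    ≡⟨ cong (θ′ k i) (θ≗θ′ i≢j _) ⟩
      θ′ k i (θ′ i j (θ j k x))   ≡⟨ cong (θ′ k i ∘ θ′ i j) (θ≗θ′ j≢k x) ⟩
      θ′ k i (θ′ i j (θ′ j k x))  ≡⟨ fixed ⟩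
      x                           ∎)
      where open ≡-Reasoning

    QuadrangleCondition-cong : QuadrangleCondition θ → QuadrangleCondition θ′
    QuadrangleCondition-cong quadrangle i j k l i≢j i≢k i≢l j≢k j≢l k≢l x fixed =
      quadrangle i j k l i≢j i≢k i≢l j≢k j≢l k≢l x (begin
        θ l k (θ k i (θ i j (θ j l x)))      ≡⟨ θ≗θ′ (≢-sym k≢l) _ ⟩
        θ′ l k (θ k i (θ i j (θ j l x)))     ≡⟨ cong (θ′ l k) (θ≗θ′ (≢-sym i≢k) _) ⟩
        θ′ l k (θ′ k i (θ i j (θ j l x)))    ≡⟨ cong (θ′ l k ∘ θ′ k i) (θ≗θ′ i≢j _) ⟩
        θ′ l k (θ′ k i (θ′ i j (θ j l x)))   ≡⟨ cong (θ′ l k ∘ θ′ k i ∘ θ′ i j) (θ≗θ′ j≢l x) ⟩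
        θ′ l k (θ′ k i (θ′ i j (θ′ j l x)))  ≡⟨ fixed ⟩
        x                                    ∎)
      where open ≡-Reasoning

-- θ i j is the paper's θ_ij for every pair i ≠ j, not only for i < j; θ i i is unconstrained.
record MooreFamily (d : ℕ) (S : Set) : Set where
  field
    θ           : Fin d → Fin d → S → S
    involutive  : ∀ {i j} → i ≢ j → ∀ x → θ i j (θ j i x) ≡ x
    triangle    : TriangleCondition θ
    quadrangle  : QuadrangleCondition θ

MooreFamily⇔permutations : ∀ {d} → MooreFamily d S ⇔
  (Σ ((i j : Fin d) → i <ᶠ j → S ↔ S) λ θ →
    TriangleCondition (θext θ) × QuadrangleCondition (θext θ))
MooreFamily⇔permutations = mk⇔
  (λ F → let open MooreFamily F
             θ≗θext = λ {i} {j} i≢j x → sym (θext-permutationsOf θ involutive {i} {j} i≢j x)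
         in permutationsOf θ involutive ,
            TriangleCondition-cong θ≗θext triangle , QuadrangleCondition-cong θ≗θext quadrangle)
  (λ (θ , triangle , quadrangle) → record
    { θ = θext θ ; involutive = θext-involutive θ ; triangle = triangle ; quadrangle = quadrangle })

Path≤2 : (A → A → Set) → A → A → Set
Path≤2 E x y = E x y ⊎ ∃ λ w → E x w × E w y

Path≤2-map : {E : A → A → Set} {E′ : B → B → Set} {g : A → B} →
             (∀ {x y} → E x y → E′ (g x) (g y)) → ∀ {x y} → Path≤2 E x y → Path≤2 E′ (g x) (g y)
Path≤2-map E⇒E′ (inj₁ x~y)             = inj₁ (E⇒E′ x~y)
Path≤2-map E⇒E′ (inj₂ (w , x~w , w~y)) = inj₂ (_ , E⇒E′ x~w , E⇒E′ w~y)

module MooreGraph⇒MooreFamily {k : ℕ} (σ : S ↔ Fin k) (G : SimpleGraph (suc k * suc k + 1))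
  (regular : IsRegular G (suc k)) (within-two : ∀ x y → x ≢ y → Path≤2 (Adjacent G) x y) where

  private
    D : ℕ
    D = suc k
    Node : Set
    Node = Fin (D * D + 1)
    module σ = Inverse σ
    variable
      x y a b : Node

  Adjacent-sym : Adjacent G x y → Adjacent G y x
  Adjacent-sym {x} {y} x~y = trans (symmetric G y x) x~y

  Adjacent⇒≢ : Adjacent G x y → x ≢ y
  Adjacent⇒≢ {x} x~x refl = contradiction (trans (sym (irrefl G x)) x~x) λ ()

  neighbours : ∀ x → Enumeration (Adjacent G x) D
  neighbours x = subst (Enumeration (Adjacent G x)) (regular x) (filterᵇ-enumeration (adj G x))

  open module Neighbours x = Enumeration (neighbours x)
    renaming (at to neighbour; at-injective to neighbour-injective;
              at-sound to neighbour-adjacent; at-complete to neighbour-complete)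

  back : Node → Fin D → Fin D
  back x i = proj₁ (neighbour-complete (neighbour x i) x (Adjacent-sym (neighbour-adjacent x i)))

  neighbour-back : ∀ x i → neighbour (neighbour x i) (back x i) ≡ x
  neighbour-back x i =
    proj₂ (neighbour-complete (neighbour x i) x (Adjacent-sym (neighbour-adjacent x i)))

  Φ : Node → Vertex D S → Node
  Φ x root         = x
  Φ x (layer₁ i)   = neighbour x i
  Φ x (layer₂ i s) = neighbour (neighbour x i) (punchIn (back x i) (σ.to s))

  Φ-layer₂ : ∀ {i} → Adjacent G (Φ x (layer₁ i)) y → y ≢ x → ∃ λ s → Φ x (layer₂ i s) ≡ y
  Φ-layer₂ {x} {y} {i} xᵢ~y y≢x = σ.from (punchOut back≢r) , (begin
    neighbour (neighbour x i) (punchIn (back x i) (σ.to (σ.from (punchOut back≢r))))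
      ≡⟨ cong (neighbour (neighbour x i) ∘ punchIn (back x i)) (σ.strictlyInverseˡ _) ⟩
    neighbour (neighbour x i) (punchIn (back x i) (punchOut back≢r))
      ≡⟨ cong (neighbour (neighbour x i)) (punchIn-punchOut back≢r) ⟩
    neighbour (neighbour x i) r
      ≡⟨ neighbour-r≡y ⟩
    y ∎)
    where
    open ≡-Reasoning
    r = proj₁ (neighbour-complete (neighbour x i) y xᵢ~y)
    neighbour-r≡y = proj₂ (neighbour-complete (neighbour x i) y xᵢ~y)
    back≢r : back x i ≢ r
    back≢r back≡r =
      y≢x (trans (sym neighbour-r≡y) (trans (cong (neighbour _) (sym back≡r)) (neighbour-back x i)))

  Φ-surjective : ∀ x → StrictlySurjective _≡_ (Φ x)
  Φ-surjective x y with x ≟ y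
  ... | yes x≡y = root , x≡y
  ... | no x≢y with within-two x y x≢y
  ... | inj₁ x~y = layer₁ (proj₁ (neighbour-complete x y x~y)) , proj₂ (neighbour-complete x y x~y)
  ... | inj₂ (w , x~w , w~y) =
    let (i , xᵢ≡w) = neighbour-complete x w x~w
        (s , xᵢₛ≡y) = Φ-layer₂ (subst (λ z → Adjacent G z y) (sym xᵢ≡w) w~y) (x≢y ∘ sym)
    in layer₂ i s , xᵢₛ≡y

  -- The graph has exactly as many vertices as Vertex D S, so the surjection Φ x is injective.
  Φ-injective : ∀ x → Injective _≡_ _≡_ (Φ x)
  Φ-injective x = ↔Fin-surjective⇒injective (Vertex↔Fin σ) (Φ-surjective x)

  triangle-free : Adjacent G x a → Adjacent G x b → ¬ Adjacent G a b
  triangle-free {x} {a} {b} x~a x~b a~b =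
    let (i , xᵢ≡a) = neighbour-complete x a x~a
        (j , xⱼ≡b) = neighbour-complete x b x~b
        (s , xᵢₛ≡b) = Φ-layer₂ (subst (λ z → Adjacent G z b) (sym xᵢ≡a) a~b) (Adjacent⇒≢ x~b ∘ sym)
    in contradiction (Φ-injective x {layer₂ i s} {layer₁ j} (trans xᵢₛ≡b (sym xⱼ≡b))) λ ()

  common-neighbour-unique : Adjacent G x a → Adjacent G a y → Adjacent G x b → Adjacent G b y →
                            y ≢ x → a ≡ b
  common-neighbour-unique {x} {a} {y} {b} x~a a~y x~b b~y y≢x =
    let (i , xᵢ≡a) = neighbour-complete x a x~a
        (j , xⱼ≡b) = neighbour-complete x b x~b
        (s , xᵢₛ≡y) = Φ-layer₂ (subst (λ z → Adjacent G z y) (sym xᵢ≡a) a~y) y≢x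
        (t , xⱼₜ≡y) = Φ-layer₂ (subst (λ z → Adjacent G z y) (sym xⱼ≡b) b~y) y≢x
        i≡j = layer₂-injectiveˡ (Φ-injective x (trans xᵢₛ≡y (sym xⱼₜ≡y)))
    in trans (sym xᵢ≡a) (trans (cong (neighbour x) i≡j) xⱼ≡b)

  private
    o : Node
    o = Inverse.to (Vertex↔Fin σ) root

  u : Fin D → Node
  u i = Φ o (layer₁ i)

  f : Fin D → S → Node
  f i s = Φ o (layer₂ i s)

  f-injectiveˡ : ∀ {i j s t} → f i s ≡ f j t → i ≡ j
  f-injectiveˡ = layer₂-injectiveˡ ∘ Φ-injective o

  f-injectiveʳ : ∀ {i s t} → f i s ≡ f i t → s ≡ t
  f-injectiveʳ = layer₂-injectiveʳ ∘ Φ-injective o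

  u-adjacent-f : ∀ i s → Adjacent G (u i) (f i s)
  u-adjacent-f i s = neighbour-adjacent (u i) _

  o-not-adjacent-f : ∀ i s → ¬ Adjacent G o (f i s)
  o-not-adjacent-f i s o~f =
    let (j , uⱼ≡f) = neighbour-complete o (f i s) o~f
    in contradiction (Φ-injective o {layer₁ j} {layer₂ i s} uⱼ≡f) λ ()

  f≢u : ∀ i s j → f i s ≢ u j
  f≢u i s j f≡u = contradiction (Φ-injective o {layer₂ i s} {layer₁ j} f≡u) λ ()

  partner : ∀ {a b} → a ≢ b → ∀ t → ∃ λ s → Adjacent G (f a s) (f b t)
  partner {a} {b} a≢b t with within-two (u a) (f b t) (≢-sym (f≢u b t a))
  ... | inj₁ uₐ~f = contradiction (f-injectiveˡ (proj₂ (Φ-layer₂ uₐ~f f≢o))) a≢b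
    where
    f≢o : f b t ≢ o
    f≢o f≡o = contradiction (Φ-injective o {layer₂ b t} {root} f≡o) λ ()
  ... | inj₂ (w , uₐ~w , w~f) =
    let (s , fₐₛ≡w) = Φ-layer₂ uₐ~w w≢o
    in s , subst (λ z → Adjacent G z (f b t)) (sym fₐₛ≡w) w~f
    where
    w≢o : w ≢ o
    w≢o w≡o = o-not-adjacent-f b t (subst (λ z → Adjacent G z (f b t)) w≡o w~f)

  partner-unique : ∀ {a b s s′ t} → Adjacent G (f a s) (f b t) → Adjacent G (f a s′) (f b t) →
                   s ≡ s′
  partner-unique {a} {b} {s} {s′} {t} fₐₛ~f fₐₛ′~f = f-injectiveʳ
    (common-neighbour-unique (u-adjacent-f a s) fₐₛ~f (u-adjacent-f a s′) fₐₛ′~f (f≢u b t a))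

  -- θ a b t is the unique s with f a s adjacent to f b t; the value for a = b is irrelevant.
  θ : Fin D → Fin D → S → S
  θ a b t with a ≟ b
  ... | yes _   = t
  ... | no a≢b  = proj₁ (partner a≢b t)

  θ-adjacent : ∀ {a b} → a ≢ b → ∀ t → Adjacent G (f a (θ a b t)) (f b t)
  θ-adjacent {a} {b} a≢b t with a ≟ b
  ... | yes a≡b  = contradiction a≡b a≢b
  ... | no a≢b′ = proj₂ (partner a≢b′ t)

  θ-involutive : ∀ {a b} → a ≢ b → ∀ t → θ a b (θ b a t) ≡ t
  θ-involutive {a} {b} a≢b t =
    partner-unique (θ-adjacent a≢b (θ b a t)) (Adjacent-sym (θ-adjacent (≢-sym a≢b) t))

  θ-triangle : TriangleCondition θ
  θ-triangle i j k i≢j i≢k j≢k s fixed = triangle-free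
    (θ-adjacent j≢k s)
    (Adjacent-sym (θ-adjacent i≢j s₁))
    (subst (λ v → Adjacent G (f k v) (f i s₂)) fixed (θ-adjacent (≢-sym i≢k) s₂))
    where
    s₁ = θ j k s
    s₂ = θ i j s₁

  θ-quadrangle : QuadrangleCondition θ
  θ-quadrangle i j k l i≢j i≢k i≢l j≢k j≢l k≢l s fixed = j≢k (f-injectiveˡ (common-neighbour-unique
    (Adjacent-sym (θ-adjacent j≢l s))
    (Adjacent-sym (θ-adjacent i≢j s₁))
    (subst (λ v → Adjacent G (f l v) (f k s₃)) fixed (θ-adjacent (≢-sym k≢l) s₃))
    (θ-adjacent (≢-sym i≢k) s₂)
    (i≢l ∘ f-injectiveˡ)))
    where
    s₁ = θ j l s
    s₂ = θ i j s₁
    s₃ = θ k i s₂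

  mooreFamily : MooreFamily D S
  mooreFamily = record
    { θ = θ ; involutive = θ-involutive ; triangle = θ-triangle ; quadrangle = θ-quadrangle }

MooreGraph⇒MooreFamily : ∀ {k} → S ↔ Fin k → MooreGraph (suc k) → MooreFamily (suc k) S
MooreGraph⇒MooreFamily σ (G , regular , within-two , _) = mooreFamily
  where open MooreGraph⇒MooreFamily σ G regular within-two

module MooreFamily⇒MooreGraph {m : ℕ} (σ : S ↔ Fin (suc m)) (F : MooreFamily (suc (suc m)) S) where

  open MooreFamily F

  private
    D : ℕ
    D = suc (suc m)
    module σ = Inverse σ

  data Edge : Vertex D S → Vertex D S → Set where
    root-layer₁   : ∀ {i} → Edge root (layer₁ i)
    layer₁-root   : ∀ {i} → Edge (layer₁ i) root
    layer₁-layer₂ : ∀ {i s} → Edge (layer₁ i) (layer₂ i s)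
    layer₂-layer₁ : ∀ {i s} → Edge (layer₂ i s) (layer₁ i)
    layer₂-layer₂ : ∀ {i j s t} → i ≢ j → s ≡ θ i j t → Edge (layer₂ i s) (layer₂ j t)

  Edge-sym : ∀ {x y} → Edge x y → Edge y x
  Edge-sym root-layer₁              = layer₁-root
  Edge-sym layer₁-root              = root-layer₁
  Edge-sym layer₁-layer₂            = layer₂-layer₁
  Edge-sym layer₂-layer₁            = layer₁-layer₂
  Edge-sym (layer₂-layer₂ i≢j refl) = layer₂-layer₂ (≢-sym i≢j) (sym (involutive (≢-sym i≢j) _))

  Edge-irreflexive : ∀ {x} → ¬ Edge x x
  Edge-irreflexive (layer₂-layer₂ i≢i _) = i≢i refl

  _≟ˢ_ : (s t : S) → Dec (s ≡ t)
  _≟ˢ_ = via-injection (↔⇒↣ σ) _≟_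

  edge? : ∀ x y → Dec (Edge x y)
  edge? root         root         = no λ ()
  edge? root         (layer₁ i)   = yes root-layer₁
  edge? root         (layer₂ i s) = no λ ()
  edge? (layer₁ i)   root         = yes layer₁-root
  edge? (layer₁ i)   (layer₁ j)   = no λ ()
  edge? (layer₁ i)   (layer₂ j s) with i ≟ j
  ... | yes refl = yes layer₁-layer₂
  ... | no i≢j   = no λ { layer₁-layer₂ → i≢j refl }
  edge? (layer₂ i s) root         = no λ ()
  edge? (layer₂ i s) (layer₁ j)   with i ≟ j
  ... | yes refl = yes layer₂-layer₁
  ... | no i≢j   = no λ { layer₂-layer₁ → i≢j refl }
  edge? (layer₂ i s) (layer₂ j t) with i ≟ j | s ≟ˢ θ i j t
  ... | yes refl | _         = no λ { (layer₂-layer₂ i≢i _) → i≢i refl }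
  ... | no i≢j   | yes s≡θt = yes (layer₂-layer₂ i≢j s≡θt)
  ... | no _     | no s≢θt  = no λ { (layer₂-layer₂ _ s≡θt) → s≢θt s≡θt }

  neighbour : Vertex D S → Fin D → Vertex D S
  neighbour root         i       = layer₁ i
  neighbour (layer₁ i)   zero    = root
  neighbour (layer₁ i)   (suc r) = layer₂ i (σ.from r)
  neighbour (layer₂ i s) zero    = layer₁ i
  neighbour (layer₂ i s) (suc r) = layer₂ (punchIn i r) (θ (punchIn i r) i s)

  neighbour-edge : ∀ x r → Edge x (neighbour x r)
  neighbour-edge root         r       = root-layer₁
  neighbour-edge (layer₁ i)   zero    = layer₁-root
  neighbour-edge (layer₁ i)   (suc r) = layer₁-layer₂
  neighbour-edge (layer₂ i s) zero    = layer₂-layer₁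
  neighbour-edge (layer₂ i s) (suc r) =
    layer₂-layer₂ (≢-sym (punchInᵢ≢i i r)) (sym (involutive (≢-sym (punchInᵢ≢i i r)) s))

  neighbour-injective : ∀ x → Injective _≡_ _≡_ (neighbour x)
  neighbour-injective root         refl = refl
  neighbour-injective (layer₁ i)   {zero}  {zero}  _  = refl
  neighbour-injective (layer₁ i)   {suc r} {suc r′} eq =
    cong suc (↔-injective (↔-sym σ) (layer₂-injectiveʳ eq))
  neighbour-injective (layer₂ i s) {zero}  {zero}  _  = refl
  neighbour-injective (layer₂ i s) {suc r} {suc r′} eq =
    cong suc (punchIn-injective i r r′ (layer₂-injectiveˡ eq))

  neighbour-complete : ∀ x y → Edge x y → ∃ λ r → neighbour x r ≡ y
  neighbour-complete root         (layer₁ i)   root-layer₁   = i , refl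
  neighbour-complete (layer₁ i)   root         layer₁-root   = zero , refl
  neighbour-complete (layer₁ i)   (layer₂ i s) layer₁-layer₂ =
    suc (σ.to s) , cong (layer₂ i) (σ.strictlyInverseʳ s)
  neighbour-complete (layer₂ i s) (layer₁ i)   layer₂-layer₁ = zero , refl
  neighbour-complete (layer₂ i _) (layer₂ j t) (layer₂-layer₂ i≢j refl) =
    suc (punchOut i≢j) , trans (cong (λ c → layer₂ c (θ c i (θ i j t))) (punchIn-punchOut i≢j))
                               (cong (layer₂ j) (involutive (≢-sym i≢j) t))

  detour≢direct : ∀ {i j c} → i ≢ c → i ≢ j → c ≢ j → ∀ t → θ i j t ≢ θ i c (θ c j t)
  detour≢direct {i} {j} {c} i≢c i≢j c≢j t direct≡detour = triangle i c j i≢c i≢j c≢j t (begin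
    θ j i (θ i c (θ c j t)) ≡⟨ cong (θ j i) direct≡detour ⟨
    θ j i (θ i j t)         ≡⟨ involutive (≢-sym i≢j) t ⟩
    t                       ∎)
    where open ≡-Reasoning

  detours-distinct : ∀ {i j c c′} → i ≢ c → i ≢ c′ → i ≢ j → c ≢ c′ → c ≢ j → c′ ≢ j →
                     ∀ t → θ i c (θ c j t) ≢ θ i c′ (θ c′ j t)
  detours-distinct {i} {j} {c} {c′} i≢c i≢c′ i≢j c≢c′ c≢j c′≢j t detour≡detour′ =
    quadrangle i c c′ j i≢c i≢c′ i≢j c≢c′ c≢j c′≢j t (begin
      θ j c′ (θ c′ i (θ i c (θ c j t)))    ≡⟨ cong (θ j c′ ∘ θ c′ i) detour≡detour′ ⟩
      θ j c′ (θ c′ i (θ i c′ (θ c′ j t)))  ≡⟨ cong (θ j c′) (involutive (≢-sym i≢c′) _) ⟩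
      θ j c′ (θ c′ j t)                    ≡⟨ involutive (≢-sym c′≢j) t ⟩
      t                                    ∎)
    where open ≡-Reasoning

  -- The m detours through the layers other than i and j are distinct and all differ from
  -- θ i j t, so by counting they exhaust the other m labels of S.
  detour-exists : ∀ {i j} → i ≢ j → ∀ {s t} → s ≢ θ i j t →
                  ∃ λ c → i ≢ c × c ≢ j × s ≡ θ i c (θ c j t)
  detour-exists {i} {j} i≢j {s} {t} s≢direct =
    let (r , hit) = punctured-injective⇒surjective avoids detour-injective (σ.to s) direct≢s
    in c r , i≢c r , c≢j r , sym (↔-injective σ hit)
    where
    c : Fin m → Fin D
    c r = punchIn i (punchIn (punchOut i≢j) r)
    i≢c : ∀ r → i ≢ c r
    i≢c r = ≢-sym (punchInᵢ≢i i _)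
    c≢j : ∀ r → c r ≢ j
    c≢j r cr≡j = punchInᵢ≢i (punchOut i≢j) r
      (punchIn-injective i _ _ (trans cr≡j (sym (punchIn-punchOut i≢j))))
    c-injective : Injective _≡_ _≡_ c
    c-injective = punchIn-injective (punchOut i≢j) _ _ ∘ punchIn-injective i _ _
    detour : Fin m → Fin (suc m)
    detour r = σ.to (θ i (c r) (θ (c r) j t))
    avoids : ∀ r → σ.to (θ i j t) ≢ detour r
    avoids r = detour≢direct (i≢c r) i≢j (c≢j r) t ∘ ↔-injective σ
    detour-injective : Injective _≡_ _≡_ detour
    detour-injective {r} {r′} eq with r ≟ r′
    ... | yes r≡r′ = r≡r′
    ... | no r≢r′  = contradiction (↔-injective σ eq)
      (detours-distinct (i≢c r) (i≢c r′) i≢j (r≢r′ ∘ c-injective) (c≢j r) (c≢j r′) t)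
    direct≢s : σ.to (θ i j t) ≢ σ.to s
    direct≢s = s≢direct ∘ sym ∘ ↔-injective σ

  within-two : ∀ x y → x ≢ y → Path≤2 Edge x y
  within-two root         root         x≢x = contradiction refl x≢x
  within-two root         (layer₁ i)   _   = inj₁ root-layer₁
  within-two root         (layer₂ i s) _   = inj₂ (layer₁ i , root-layer₁ , layer₁-layer₂)
  within-two (layer₁ i)   root         _   = inj₁ layer₁-root
  within-two (layer₁ i)   (layer₁ j)   _   = inj₂ (root , layer₁-root , root-layer₁)
  within-two (layer₁ i)   (layer₂ j t) _ with i ≟ j
  ... | yes refl = inj₁ layer₁-layer₂
  ... | no i≢j   = inj₂ (layer₂ i (θ i j t) , layer₁-layer₂ , layer₂-layer₂ i≢j refl)
  within-two (layer₂ i s) root         _   = inj₂ (layer₁ i , layer₂-layer₁ , layer₁-root)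
  within-two (layer₂ i s) (layer₁ j)   _ with i ≟ j
  ... | yes refl = inj₁ layer₂-layer₁
  ... | no i≢j   =
    inj₂ (layer₂ j (θ j i s) , layer₂-layer₂ i≢j (sym (involutive i≢j s)) , layer₂-layer₁)
  within-two (layer₂ i s) (layer₂ j t) _ with i ≟ j
  ... | yes refl = inj₂ (layer₁ i , layer₂-layer₁ , layer₁-layer₂)
  ... | no i≢j with s ≟ˢ θ i j t
  ... | yes s≡direct = inj₁ (layer₂-layer₂ i≢j s≡direct)
  ... | no s≢direct  =
    let (c , i≢c , c≢j , s≡detour) = detour-exists i≢j s≢direct
    in inj₂ (layer₂ c (θ c j t) , layer₂-layer₂ i≢c s≡detour , layer₂-layer₂ c≢j refl)

  private
    module V = Inverse (Vertex↔Fin σ)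

  graph : SimpleGraph (D * D + 1)
  graph = record
    { adj       = λ a b → does (edge? (V.from a) (V.from b))
    ; irrefl    = λ a → dec-false (edge? (V.from a) (V.from a)) Edge-irreflexive
    ; symmetric = λ a b → does-⇔ (mk⇔ Edge-sym Edge-sym)
                            (edge? (V.from a) (V.from b)) (edge? (V.from b) (V.from a))
    }

  Edge⇒Adjacent : ∀ {x y} → Edge x y → Adjacent graph (V.to x) (V.to y)
  Edge⇒Adjacent {x} {y} x~y =
    dec-true (edge? _ _) (subst₂ Edge (sym (V.strictlyInverseʳ x)) (sym (V.strictlyInverseʳ y)) x~y)

  Adjacent⇒Edge : ∀ {a b} → Adjacent graph a b → Edge (V.from a) (V.from b)
  Adjacent⇒Edge {a} {b} a~b with edge? (V.from a) (V.from b)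
  ... | yes edge = edge

  neighbours : ∀ a → Enumeration (Adjacent graph a) D
  neighbours a = record
    { at           = V.to ∘ neighbour (V.from a)
    ; at-injective = neighbour-injective (V.from a) ∘ ↔-injective (Vertex↔Fin σ)
    ; at-sound     = λ r → subst (λ a′ → Adjacent graph a′ (V.to (neighbour (V.from a) r)))
                             (V.strictlyInverseˡ a) (Edge⇒Adjacent (neighbour-edge (V.from a) r))
    ; at-complete  = λ b a~b → let (r , eq) = neighbour-complete _ _ (Adjacent⇒Edge a~b)
                               in r , trans (cong V.to eq) (V.strictlyInverseˡ b)
    }

  graph-regular : IsRegular graph D
  graph-regular a = Enumeration-size-unique (filterᵇ-enumeration (adj graph a)) (neighbours a)

  graph-diameter-two : HasDiameterTwo graph
  graph-diameter-two =
    (λ a b a≢b → subst₂ (Path≤2 (Adjacent graph)) (V.strictlyInverseˡ a) (V.strictlyInverseˡ b)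
                  (Path≤2-map {E′ = Adjacent graph} {g = V.to} Edge⇒Adjacent
                    (within-two _ _ (a≢b ∘ from-injective)))) ,
    (V.to root , V.to s₀ , root≢s₀ ∘ ↔-injective (Vertex↔Fin σ) , not-adjacent ,
     V.to (layer₁ zero) , Edge⇒Adjacent (root-layer₁ {zero}) , Edge⇒Adjacent layer₁-layer₂)
    where
    s₀ : Vertex D S
    s₀ = layer₂ zero (σ.from zero)
    root≢s₀ : root ≢ s₀
    root≢s₀ ()
    from-injective : ∀ {a b} → V.from a ≡ V.from b → a ≡ b
    from-injective = ↔-injective (↔-sym (Vertex↔Fin σ))
    not-adjacent : ¬ Adjacent graph (V.to root) (V.to s₀)
    not-adjacent root~s₀ =
      contradiction (subst₂ Edge (V.strictlyInverseʳ root) (V.strictlyInverseʳ s₀)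
                                    (Adjacent⇒Edge root~s₀)) λ ()

  mooreGraph : MooreGraph D
  mooreGraph = graph , graph-regular , graph-diameter-two

MooreFamily⇒MooreGraph : ∀ {m} → S ↔ Fin (suc m) → MooreFamily (suc (suc m)) S →
                         MooreGraph (suc (suc m))
MooreFamily⇒MooreGraph σ F = mooreGraph
  where open MooreFamily⇒MooreGraph σ F

corollary5 : (d : ℕ) → 2 ≤ d → (S : Set) → S ↔ Fin (d ∸ 1) →
    MooreGraph d ⇔
      (Σ ((i j : Fin d) → i <ᶠ j → S ↔ S) λ θ →
        (∀ (i j k : Fin d) → i ≢ j → i ≢ k → j ≢ k →
          FixedPointFree (θext θ k i ∘ θext θ i j ∘ θext θ j k))
        × (∀ (i j k l : Fin d) → i ≢ j → i ≢ k → i ≢ l → j ≢ k → j ≢ l → k ≢ l →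
          FixedPointFree (θext θ l k ∘ θext θ k i ∘ θext θ i j ∘ θext θ j l)))
corollary5 (suc (suc m)) (s≤s (s≤s z≤n)) S σ = mk⇔
  (Equivalence.to MooreFamily⇔permutations ∘ MooreGraph⇒MooreFamily σ)
  (MooreFamily⇒MooreGraph σ ∘ Equivalence.from MooreFamily⇔permutations)
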